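{- Let $\theta:\mathbb{N}\to\mathbb{R}\cup\{\infty\}$ satisfy $\theta(1)\ge 2$ and $\theta(n)\ge P^+(n)$ for all $n\ge 2$. Let $\mathcal{B}$ and $\mathcal{D}$ be as in the context, with counting functions $B(x)$, $D(x)$. (i) $\mathcal{D}\subseteq\mathcal{B}$, hence $D(x)\le B(x)$. (ii) If moreover $\theta(n)\le\theta(n+1)$ for all $n\ge1$ and $m\theta(n)\le\theta(mn)$ for all $n,m\ge1$ with $\gcd(n,m)=1$, then $\mathcal{D}=\mathcal{B}$, hence $D(x)=B(x)$.
   Context: $P^+(n)$ is the largest prime factor of $n\ge2$. $\mathcal{B}$ is the set of positive integers consisting of $1$ and all $n\ge2$ with factorization $n=p_1^{\alpha_1}\cdots p_k^{\alpha_k}$, $p_1<\cdots<p_k$, such that $p_{j+1}\le\theta(p_1^{\alpha_1}\cdots p_j^{\alpha_j})$ for $0\le j<k$ (empty product $=1$). $\mathcal{D}$ is the set of positive integers consisting of $1$ and all $n\ge2$ whose divisors $1=d_1<d_2<\cdots<d_{\tau(n)}=n$ satisfy $d_{j+1}\le\theta(d_j)$ for $1\le j<\tau(n)$. $B(x)$, $D(x)$ count elements $\le x$ of $\mathcal{B}$, $\mathcal{D}$ respectively.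
   Formalization: The function θ takes values in the rationals together with ∞ rather than in $\mathbb{R}\cup\{\infty\}$. -}

module Defs where

open import Data.Nat using (ℕ; suc; _*_; _^_; _<_; _≤_)
open import Data.Nat.Divisibility using (_∣_)
open import Data.Nat.Primality using (Prime)
open import Data.Integer using (+_)
open import Data.Rational as ℚ using (ℚ; _/_)
open import Data.Product using (_×_; _,_; ∃; proj₁)
open import Data.List using (List; []; _∷_)
open import Data.List.Relation.Unary.All using (All)
open import Data.List.Relation.Unary.Linked using (Linked)
open import Data.Unit using (⊤)
open import Relation.Binary.PropositionalEquality using (_≡_)

-- Extended rationals ℚ ∪ {∞} (stand-in for ℝ ∪ {∞}).
data ℚ∞ : Set where
  fin : ℚ → ℚ∞
  ∞   : ℚ∞

infix 4 _≤∞_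
data _≤∞_ : ℚ∞ → ℚ∞ → Set where
  fin≤fin : ∀ {a b} → a ℚ.≤ b → fin a ≤∞ fin b
  _≤∞∞    : ∀ x → x ≤∞ ∞

ι : ℕ → ℚ∞
ι k = fin (+ k / 1)

-- m · x  for a natural m (used only with m ≥ 1, where m · ∞ = ∞)
_·∞_ : ℕ → ℚ∞ → ℚ∞
m ·∞ fin q = fin ((+ m / 1) ℚ.* q)
m ·∞ ∞     = ∞

IsLargestPrimeFactor : ℕ → ℕ → Set
IsLargestPrimeFactor n p = Prime p × p ∣ n × (∀ q → Prime q → q ∣ n → q ≤ p)

-- Prime factorisation n = p₁^α₁ ⋯ p_k^α_k, p₁ < ⋯ < p_k, αᵢ ≥ 1,
-- given as the list [(p₁,α₁), …, (p_k,α_k)].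
prodPP : List (ℕ × ℕ) → ℕ
prodPP []            = 1
prodPP ((p , a) ∷ fs) = p ^ a * prodPP fs

IsFactorisation : ℕ → List (ℕ × ℕ) → Set
IsFactorisation n fs =
  All (λ pa → Prime (proj₁ pa) × 1 ≤ Data.Product.proj₂ pa) fs
  × Linked (λ x y → proj₁ x < proj₁ y) fs
  × prodPP fs ≡ n

-- condition p_{j+1} ≤ θ(p₁^α₁ ⋯ p_j^α_j) along the list, acc = p₁^α₁ ⋯ p_j^α_j
BCond : (ℕ → ℚ∞) → ℕ → List (ℕ × ℕ) → Set
BCond θ acc []             = ⊤
BCond θ acc ((p , a) ∷ fs) = ι p ≤∞ θ acc × BCond θ (acc * p ^ a) fs

-- membership in 𝓑 (n = 1 has the empty factorisation; n = 0 has none)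
InB : (ℕ → ℚ∞) → ℕ → Set
InB θ n = ∃ λ fs → IsFactorisation n fs × BCond θ 1 fs

InD : (ℕ → ℚ∞) → ℕ → Set
InD θ n = 1 ≤ n ×
  (∀ d e → d ∣ n → e ∣ n → d < e →
     (∀ c → c ∣ n → d < c → e ≤ c) → ι e ≤∞ θ d)

-- Call n a θ-ladder if every proper divisor d of n is followed by some divisor e of n with
-- d < e ≤ θ(d); taking for e the next divisor shows that this is the same as n ∈ 𝓓.
--
-- If every prime factor of m is at least p, then every divisor of k·m exceeding k is at
-- least p, since a smaller one would be coprime to m and so divide k. For k = p₁^α₁⋯p_j^α_j
-- and p = p_{j+1}, the ladder step from k therefore gives p_{j+1} ≤ θ(k), the condition of 𝓑.
--
-- Conversely, let θ be monotone with m·θ(c) ≤ θ(m·c) for coprime c, m. Then the ladder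
-- property passes from k to k·p^a whenever p ∤ k and p ≤ θ(k). Write a proper divisor as
-- p^i·d′ with d′ ∣ k. If d′ < k, it steps to p^i·e′, where e′ is the step from d′. If
-- d′ = k < p, it steps to p^(i+1). If d′ = k > p, let c be the largest divisor of k with
-- c·p < k and e″ its step: maximality gives e″·p > k, so p^i·k steps to p^(i+1)·e″, because
-- θ(p^i·k) ≥ θ(p^(i+1)·c) ≥ p^(i+1)·θ(c).

module Submission where

open import Defs
open import Data.Integer as ℤ using (+_)
import Data.Integer.Properties as ℤₚ
open import Data.List using ([]; _∷_)
open import Data.List.Relation.Unary.All as All using (All; []; _∷_)
open import Data.List.Relation.Unary.AllPairs using (_∷_)
open import Data.List.Relation.Unary.Linked as Linked using (Linked; []; [-]; _∷_)
open import Data.List.Relation.Unary.Linked.Properties using (Linked⇒AllPairs)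
open import Data.Nat.Base hiding (_/_)
open import Data.Nat.Coprimality as Coprime using (Coprime; coprime-divisor)
open import Data.Nat.Divisibility
open import Data.Nat.Induction using (<-wellFounded)
open import Data.Nat.Primality
open import Data.Nat.Properties
open import Data.Nat.Solver using (module +-*-Solver)
open import Data.Product using (_×_; _,_; proj₁; proj₂; ∃; ∃₂)
open import Data.Rational as ℚ using (_/_; mkℚ)
import Data.Rational.Properties as ℚₚ
open import Data.Sum using (inj₁; inj₂)
open import Function.Base using (_on_; _∘_)
open import Function.Bundles using (_⇔_; mk⇔)
open import Induction.WellFounded using (Acc; acc)
open import Relation.Binary.Definitions using (tri<; tri≈; tri>)
open import Relation.Binary.PropositionalEquality
open import Relation.Nullary using (¬_; yes; no; contradiction)
open import Relation.Nullary.Decidable using (_×-dec_)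
open import Relation.Unary using (Decidable)

≤∞-refl : ∀ {x} → x ≤∞ x
≤∞-refl {fin q} = fin≤fin ℚₚ.≤-refl
≤∞-refl {∞}     = ∞ ≤∞∞

≤∞-trans : ∀ {x y z} → x ≤∞ y → y ≤∞ z → x ≤∞ z
≤∞-trans (fin≤fin p) (fin≤fin q) = fin≤fin (ℚₚ.≤-trans p q)
≤∞-trans {x} _ (_ ≤∞∞)          = x ≤∞∞

ℕ/1≡mkℚ : ∀ k → + k / 1 ≡ mkℚ (+ k) 0 (λ (_ , d∣1) → ∣1⇒≡1 d∣1)
ℕ/1≡mkℚ k = ℚₚ.normalize-coprime _

ι-mono : ∀ {m n} → m ≤ n → ι m ≤∞ ι n
ι-mono {m} {n} m≤n rewrite ℕ/1≡mkℚ m | ℕ/1≡mkℚ n =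
  fin≤fin (ℚ.*≤* (subst₂ ℤ._≤_ (sym (ℤₚ.*-identityʳ (+ m))) (sym (ℤₚ.*-identityʳ (+ n)))
                                (ℤ.+≤+ m≤n)))

ι-*-mono-·∞ : ∀ m {e x} → ι e ≤∞ x → ι (m * e) ≤∞ m ·∞ x
ι-*-mono-·∞ m {e} (fin≤fin {b = q} e≤q) =
  fin≤fin (subst (ℚ._≤ (+ m / 1) ℚ.* q) ι-*-homo
    (ℚₚ.*-monoˡ-≤-nonNeg (+ m / 1) {{ℚₚ.normalize-nonNeg m 1}} e≤q))
  where
  ι-*-homo : (+ m / 1) ℚ.* (+ e / 1) ≡ + (m * e) / 1
  ι-*-homo rewrite ℕ/1≡mkℚ m | ℕ/1≡mkℚ e = cong (_/ 1) (sym (ℤₚ.pos-* m e))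
ι-*-mono-·∞ m (_ ≤∞∞) = _ ≤∞∞

module _ {P : ℕ → Set} (P? : Decidable P) where

  least : ∀ {w} → P w → ∃ λ e → P e × (∀ {c} → P c → e ≤ c)
  least {w} = go (<-wellFounded w)
    where
    go : ∀ {w} → Acc _<_ w → P w → ∃ λ e → P e × (∀ {c} → P c → e ≤ c)
    go {w} (acc smaller) Pw with anyUpTo? P? w
    ... | yes (c , c<w , Pc) = go (smaller c<w) Pc
    ... | no ∄c<w            = w , Pw , λ {c} Pc → ≮⇒≥ (λ c<w → ∄c<w (c , c<w , Pc))

  greatest : ∀ B → (∀ {c} → P c → c ≤ B) →
             ∀ {w} → P w → ∃ λ c → P c × (∀ {c′} → P c′ → c′ ≤ c)
  greatest B bounded Pw with P? B
  ... | yes PB = B , PB , bounded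
  greatest zero    bounded Pw | no ¬PB = contradiction (subst P (n≤0⇒n≡0 (bounded Pw)) Pw) ¬PB
  greatest (suc B) bounded Pw | no ¬PB = greatest B below Pw
    where
    below : ∀ {c} → P c → c ≤ B
    below Pc = s≤s⁻¹ (≤∧≢⇒< (bounded Pc) (λ c≡1+B → ¬PB (subst P c≡1+B Pc)))

∣-nonZero : ∀ {d n} .{{_ : NonZero n}} → d ∣ n → NonZero d
∣-nonZero {zero}  {n} 0∣n = contradiction (0∣⇒≡0 0∣n) (≢-nonZero⁻¹ n)
∣-nonZero {suc _} _       = _

^-monoʳ-∣ : ∀ p {i a} → i ≤ a → p ^ i ∣ p ^ a
^-monoʳ-∣ p {a = a} z≤n = 1∣ (p ^ a)
^-monoʳ-∣ p (s≤s i≤a)   = *-monoʳ-∣ p (^-monoʳ-∣ p i≤a)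

pⁱ[xp]≡pⁱ⁺¹x : ∀ p i x → p ^ i * (x * p) ≡ p ^ suc i * x
pⁱ[xp]≡pⁱ⁺¹x p i x = solve 3 (λ p pⁱ x → pⁱ :* (x :* p) := (p :* pⁱ) :* x) refl p (p ^ i) x
  where open +-*-Solver

prime∤1 : ∀ {p} → Prime p → ¬ p ∣ 1
prime∤1 p-prime p∣1 = ¬prime[1] (subst Prime (∣1⇒≡1 p∣1) p-prime)

leastPrimeFactor : ∀ {m} → 2 ≤ m → ∃ λ p → Prime p × p ∣ m × p Rough m
leastPrimeFactor {m} 2≤m with least (λ c → 2 ≤? c ×-dec c ∣? m) (2≤m , ∣-refl)
... | p , (2≤p , p∣m) , minimal = p , rough∧∣⇒prime p-rough p∣m , p∣m , p-rough
  where
  instance _ = n>1⇒nonTrivial 2≤p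
  p-rough : p Rough m
  p-rough (hasNonTrivialDivisor {d} d<p d∣m) = <⇒≱ d<p (minimal (nonTrivial⇒n>1 d , d∣m))

noCommonPrime⇒coprime : ∀ {m n} → (∀ {r} → Prime r → r ∣ m → ¬ r ∣ n) → Coprime m n
noCommonPrime⇒coprime none {zero} (0∣m , 0∣n) =
  contradiction (∣-trans (2 ∣0) 0∣n) (none prime[2] (∣-trans (2 ∣0) 0∣m))
noCommonPrime⇒coprime none {1} _ = refl
noCommonPrime⇒coprime none {d@(2+ _)} (d∣m , d∣n) with leastPrimeFactor {d} (s≤s (s≤s z≤n))
... | r , r-prime , r∣d , _ =
  contradiction (∣-trans r∣d d∣n) (none r-prime (∣-trans r∣d d∣m))

prime∣^⇒≡ : ∀ {p q} a → Prime p → Prime q → q ∣ p ^ a → q ≡ p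
prime∣^⇒≡ zero _ q-prime q∣1 = contradiction q∣1 (prime∤1 q-prime)
prime∣^⇒≡ {p} (suc a) p-prime q-prime q∣pᵃ⁺¹
  with euclidsLemma p (p ^ a) q-prime q∣pᵃ⁺¹
... | inj₂ q∣pᵃ = prime∣^⇒≡ a p-prime q-prime q∣pᵃ
... | inj₁ q∣p with prime⇒irreducible p-prime q∣p
...   | inj₁ q≡1 = contradiction (subst Prime q≡1 q-prime) ¬prime[1]
...   | inj₂ q≡p = q≡p

∤⇒coprime-^ : ∀ {p x} j → Prime p → ¬ p ∣ x → Coprime x (p ^ j)
∤⇒coprime-^ j p-prime p∤x = noCommonPrime⇒coprime λ r-prime r∣x r∣pʲ →
  p∤x (subst (_∣ _) (prime∣^⇒≡ j p-prime r-prime r∣pʲ) r∣x)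

prime∤*^ : ∀ {p q x} a → Prime p → Prime q → q ≢ p → ¬ q ∣ x → ¬ q ∣ x * p ^ a
prime∤*^ {p} {x = x} a p-prime q-prime q≢p q∤x q∣xpᵃ
  with euclidsLemma x (p ^ a) q-prime q∣xpᵃ
... | inj₁ q∣x  = q∤x q∣x
... | inj₂ q∣pᵃ = q≢p (prime∣^⇒≡ a p-prime q-prime q∣pᵃ)

factorOutPower : ∀ p .{{_ : NonTrivial p}} m .{{_ : NonZero m}} →
                 ∃₂ λ a m′ → m ≡ p ^ a * m′ × ¬ p ∣ m′
factorOutPower p m = go m (<-wellFounded m)
  where
  go : ∀ m .{{_ : NonZero m}} → Acc _<_ m → ∃₂ λ a m′ → m ≡ p ^ a * m′ × ¬ p ∣ m′
  go m (acc smaller) with p ∣? m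
  ... | no p∤m = 0 , m , sym (*-identityˡ m) , p∤m
  ... | yes p∣m with go (quotient p∣m) {{quotient≢0 p∣m}} (smaller (quotient-< p∣m))
  ...   | a , m′ , q≡pᵃm′ , p∤m′ = suc a , m′ , m≡pᵃ⁺¹m′ , p∤m′
    where
    open ≡-Reasoning
    m≡pᵃ⁺¹m′ : m ≡ p ^ suc a * m′
    m≡pᵃ⁺¹m′ = begin
      m                ≡⟨ m∣n⇒n≡m*quotient p∣m ⟩
      p * quotient p∣m ≡⟨ cong (p *_) q≡pᵃm′ ⟩
      p * (p ^ a * m′) ≡⟨ *-assoc p (p ^ a) m′ ⟨
      p ^ suc a * m′   ∎

divisor-*-prime-power : ∀ {k p a d} .{{_ : NonZero k}} → Prime p → ¬ p ∣ k → d ∣ k * p ^ a →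
                        ∃₂ λ i d′ → d ≡ p ^ i * d′ × i ≤ a × d′ ∣ k × ¬ p ∣ d′
divisor-*-prime-power {k} {p} {a} {d} p-prime p∤k d∣kpᵃ =
  let i , d′ , d≡pⁱd′ , p∤d′ = factorOutPower p d {{∣-nonZero d∣kpᵃ}}
  in  i , d′ , d≡pⁱd′ , i≤a {i} d≡pⁱd′ , d′∣k {i} d≡pⁱd′ p∤d′ , p∤d′
  where
  instance
    p-nonTrivial : NonTrivial p
    p-nonTrivial = prime⇒nonTrivial p-prime
    pᵃ-nonZero : NonZero (p ^ a)
    pᵃ-nonZero = m^n≢0 p a {{prime⇒nonZero p-prime}}
    kpᵃ-nonZero : NonZero (k * p ^ a)
    kpᵃ-nonZero = m*n≢0 k (p ^ a)
  d′∣k : ∀ {i d′} → d ≡ p ^ i * d′ → ¬ p ∣ d′ → d′ ∣ k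
  d′∣k {i} {d′} d≡pⁱd′ p∤d′ = coprime-divisor (∤⇒coprime-^ a p-prime p∤d′)
    (subst (d′ ∣_) (*-comm k (p ^ a)) (∣-trans (divides (p ^ i) d≡pⁱd′) d∣kpᵃ))
  i≤a : ∀ {i d′} → d ≡ p ^ i * d′ → i ≤ a
  i≤a {i} {d′} d≡pⁱd′ = ≮⇒≥ λ a<i → <⇒≱ (^-monoʳ-< p (nonTrivial⇒n>1 p) a<i) (∣⇒≤ pⁱ∣pᵃ)
    where
    pⁱ∣pᵃ : p ^ i ∣ p ^ a
    pⁱ∣pᵃ = coprime-divisor (Coprime.sym (∤⇒coprime-^ i p-prime p∤k))
              (∣-trans (divides d′ (trans d≡pⁱd′ (*-comm (p ^ i) d′))) d∣kpᵃ)

rough-cofactor⇒≤ : ∀ {p k m e} .{{_ : NonZero k}} → p Rough m → e ∣ k * m → k < e → p ≤ e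
rough-cofactor⇒≤ {p} {k} {m} {e} p-rough e∣km k<e = ≮⇒≥ e≮p
  where
  instance _ = >-nonZero (≤-<-trans z≤n k<e)
  e≮p : ¬ e < p
  e≮p e<p = <⇒≱ k<e (∣⇒≤ (coprime-divisor e-coprime-m (subst (e ∣_) (*-comm k m) e∣km)))
    where
    e-coprime-m : Coprime e m
    e-coprime-m {zero}     (0∣e , _)   = contradiction (0∣⇒≡0 0∣e) (≢-nonZero⁻¹ e)
    e-coprime-m {1}        _           = refl
    e-coprime-m {d@(2+ _)} (d∣e , d∣m) =
      contradiction (hasNonTrivialDivisor (≤-<-trans (∣⇒≤ d∣e) e<p) d∣m) p-rough

PrimePower : ℕ × ℕ → Set
PrimePower pa = Prime (proj₁ pa) × 1 ≤ proj₂ pa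

prodPP-nonZero : ∀ {fs} → All PrimePower fs → NonZero (prodPP fs)
prodPP-nonZero [] = _
prodPP-nonZero {(p , a) ∷ fs} ((p-prime , _) ∷ primes) =
  m*n≢0 (p ^ a) (prodPP fs) {{m^n≢0 p a {{prime⇒nonZero p-prime}}}} {{prodPP-nonZero primes}}

All⇒Linked-∷ : ∀ {A : Set} {R : A → A → Set} {x xs} →
               All (R x) xs → Linked R xs → Linked R (x ∷ xs)
All⇒Linked-∷ []        []     = [-]
All⇒Linked-∷ (Rxy ∷ _) linked = Rxy ∷ linked

LadderStep : (ℕ → ℚ∞) → ℕ → ℕ → Set
LadderStep θ n d = ∃ λ e → e ∣ n × d < e × ι e ≤∞ θ d

DivisorLadder : (ℕ → ℚ∞) → ℕ → Set
DivisorLadder θ n = ∀ {d} → d ∣ n → d < n → LadderStep θ n d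

ladder-1 : ∀ {θ} → DivisorLadder θ 1
ladder-1 {d = zero}  0∣1 _ = contradiction (0∣⇒≡0 0∣1) λ ()
ladder-1 {d = suc _} _ (s≤s ())

InD⇒ladder : ∀ {θ n} → InD θ n → DivisorLadder θ n
InD⇒ladder {n = n} (_ , consecutive) {d} d∣n d<n
  with least (λ c → c ∣? n ×-dec d <? c) (∣-refl , d<n)
... | e , (e∣n , d<e) , next =
  e , e∣n , d<e , consecutive d e d∣n e∣n d<e (λ c c∣n d<c → next (c∣n , d<c))

ladder⇒InD : ∀ {θ n} → 1 ≤ n → DivisorLadder θ n → InD θ n
ladder⇒InD 1≤n ladder = 1≤n , λ d e d∣n e∣n d<e next →
  let e′ , e′∣n , d<e′ , e′≤θd = ladder d∣n (<-≤-trans d<e (∣⇒≤ {{>-nonZero 1≤n}} e∣n))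
  in  ≤∞-trans (ι-mono (next e′ e′∣n d<e′)) e′≤θd

ladder⇒rough≤θ : ∀ {θ k m p} .{{_ : NonZero k}} →
                 DivisorLadder θ (k * m) → 1 < m → p Rough m → ι p ≤∞ θ k
ladder⇒rough≤θ {k = k} {m} ladder 1<m p-rough =
  let e , e∣km , k<e , e≤θk = ladder (m∣m*n m) (m<m*n k m 1<m)
  in  ≤∞-trans (ι-mono (rough-cofactor⇒≤ p-rough e∣km k<e)) e≤θk

module _ {θ : ℕ → ℚ∞} {n : ℕ} .{{_ : NonZero n}} (ladder : DivisorLadder θ n) where

  ladder⇒factorisation : ∀ {r m k} → Acc _<_ m → .{{_ : NonZero m}} → k * m ≡ n → r Rough m →
    ∃ λ fs → IsFactorisation m fs × All (λ pa → r ≤ proj₁ pa) fs × BCond θ k fs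
  ladder⇒factorisation {m = 1} _ _ _ = [] , ([] , [] , refl) , [] , _
  ladder⇒factorisation {r} {m@(2+ _)} {k} (acc smaller) km≡n r-rough
    with leastPrimeFactor {m} (s≤s (s≤s z≤n))
  ... | p , p-prime , p∣m , p-rough with factorOutPower p {{prime⇒nonTrivial p-prime}} m
  ...   | zero , m′ , m≡1*m′ , p∤m′ =
          contradiction (subst (p ∣_) (trans m≡1*m′ (*-identityˡ m′)) p∣m) p∤m′
  ...   | suc a , m′ , m≡pᵃm′ , p∤m′
          with ladder⇒factorisation (smaller m′<m) {{∣-nonZero m′∣m}} kpᵃm′≡n
                 (∤⇒rough-suc p∤m′ (rough∧∣⇒rough p-rough m′∣m))
    where
    m′∣m : m′ ∣ m
    m′∣m = divides (p ^ suc a) m≡pᵃm′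
    m′<m : m′ < m
    m′<m = ≤∧≢⇒< (∣⇒≤ m′∣m) (λ m′≡m → p∤m′ (subst (p ∣_) (sym m′≡m) p∣m))
    kpᵃm′≡n : k * p ^ suc a * m′ ≡ n
    kpᵃm′≡n = trans (*-assoc k (p ^ suc a) m′) (trans (cong (k *_) (sym m≡pᵃm′)) km≡n)
  ...     | fs , (primes , sorted , ∏fs≡m′) , above-p , bcond =
    (p , suc a) ∷ fs ,
    ( (p-prime , s≤s z≤n) ∷ primes
    , All⇒Linked-∷ above-p sorted
    , trans (cong (p ^ suc a *_) ∏fs≡m′) (sym m≡pᵃm′) ) ,
    r≤p ∷ All.map (λ p<q → ≤-trans r≤p (<⇒≤ p<q)) above-p ,
    ladder⇒rough≤θ {{k-nonZero}} (subst (DivisorLadder θ) (sym km≡n) ladder) (s≤s (s≤s z≤n)) p-rough ,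
    bcond
    where
    r≤p : r ≤ p
    r≤p = rough⇒≤ {{prime⇒nonTrivial p-prime}} (rough∧∣⇒rough r-rough p∣m)
    k-nonZero : NonZero k
    k-nonZero = ∣-nonZero (divides m (trans (sym km≡n) (*-comm k m)))

InD⇒InB : ∀ {θ} n → InD θ n → InB θ n
InD⇒InB n n∈𝓓@(1≤n , _) =
  let fs , factorisation , _ , bcond =
        ladder⇒factorisation (InD⇒ladder n∈𝓓) (<-wellFounded n) (*-identityˡ n) 0-rough
  in  fs , factorisation , bcond
  where instance _ = >-nonZero 1≤n

module _ {θ : ℕ → ℚ∞}
  (θ-mono : ∀ n → 1 ≤ n → θ n ≤∞ θ (suc n))
  (θ-coprime-* : ∀ n m → 1 ≤ n → 1 ≤ m → Coprime n m → m ·∞ θ n ≤∞ θ (m * n)) where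

  θ-monotone : ∀ {x y} → 1 ≤ x → x ≤ y → θ x ≤∞ θ y
  θ-monotone {x} 1≤x x≤y = go (≤⇒≤′ x≤y)
    where
    go : ∀ {y} → x ≤′ y → θ x ≤∞ θ y
    go ≤′-refl                = ≤∞-refl
    go (≤′-step {n = y} x≤′y) = ≤∞-trans (go x≤′y) (θ-mono y (≤-trans 1≤x (≤′⇒≤ x≤′y)))

  ι≤θ-coprime-scale : ∀ {c m d f} .{{_ : NonZero c}} .{{_ : NonZero m}} →
                      Coprime c m → m * c ≤ d → ι f ≤∞ θ c → ι (m * f) ≤∞ θ d
  ι≤θ-coprime-scale {c} {m} c-coprime-m mc≤d f≤θc =
    ≤∞-trans (ι-*-mono-·∞ m f≤θc)
      (≤∞-trans (θ-coprime-* c m (>-nonZero⁻¹ c) (>-nonZero⁻¹ m) c-coprime-m)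
                (θ-monotone (>-nonZero⁻¹ (m * c) {{m*n≢0 m c}}) mc≤d))

  module _ {k p : ℕ} .{{_ : NonZero k}} (ladder : DivisorLadder θ k)
           (p-prime : Prime p) (p∤k : ¬ p ∣ k) where

    private instance
      p-nonZero : NonZero p
      p-nonZero = prime⇒nonZero p-prime

    pⁱ-nonZero : ∀ i → NonZero (p ^ i)
    pⁱ-nonZero i = m^n≢0 p i

    pⁱe∣kpᵃ : ∀ {i a e} → i ≤ a → e ∣ k → p ^ i * e ∣ k * p ^ a
    pⁱe∣kpᵃ {i} {a} {e} i≤a e∣k =
      subst (p ^ i * e ∣_) (*-comm (p ^ a) k) (*-pres-∣ (^-monoʳ-∣ p i≤a) e∣k)

    cp<k⇒c<k : ∀ {c} → c * p < k → c < k
    cp<k⇒c<k {c} = ≤-<-trans (m≤m*n c p)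

    pⁱk<kpᵃ⇒i<a : ∀ {i a} → i ≤ a → p ^ i * k < k * p ^ a → i < a
    pⁱk<kpᵃ⇒i<a {a = a} i≤a pⁱk<kpᵃ =
      ≤∧≢⇒< i≤a (λ { refl → <-irrefl (*-comm (p ^ a) k) pⁱk<kpᵃ })

    step-below-k : ∀ {i a d′} → i ≤ a → d′ ∣ k → d′ < k → ¬ p ∣ d′ →
                   LadderStep θ (k * p ^ a) (p ^ i * d′)
    step-below-k {i} i≤a d′∣k d′<k p∤d′ =
      let e , e∣k , d′<e , e≤θd′ = ladder d′∣k d′<k
      in  p ^ i * e , pⁱe∣kpᵃ i≤a e∣k , *-monoʳ-< (p ^ i) d′<e ,
          ι≤θ-coprime-scale {{∣-nonZero d′∣k}} (∤⇒coprime-^ i p-prime p∤d′) ≤-refl e≤θd′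
      where instance _ = pⁱ-nonZero i

    step-by-p : ∀ {i a} → i < a → k < p → ι p ≤∞ θ k → LadderStep θ (k * p ^ a) (p ^ i * k)
    step-by-p {i} {a} i<a k<p p≤θk =
      p ^ i * p ,
      subst (_∣ k * p ^ a) (*-comm p (p ^ i)) (∣-trans (^-monoʳ-∣ p i<a) (n∣m*n k)) ,
      *-monoʳ-< (p ^ i) k<p ,
      ι≤θ-coprime-scale (∤⇒coprime-^ i p-prime p∤k) ≤-refl p≤θk
      where instance _ = pⁱ-nonZero i

    step-via-largest : ∀ {i a} → i < a → p < k → LadderStep θ (k * p ^ a) (p ^ i * k)
    step-via-largest {i} i<a p<k
      with greatest (λ c → c ∣? k ×-dec c * p <? k) k (λ (_ , cp<k) → <⇒≤ (cp<k⇒c<k cp<k))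
                    (1∣ k , subst (_< k) (sym (*-identityˡ p)) p<k)
    ... | c , (c∣k , cp<k) , largest with ladder c∣k (cp<k⇒c<k cp<k)
    ...   | e , e∣k , c<e , e≤θc =
      p ^ suc i * e ,
      pⁱe∣kpᵃ i<a e∣k ,
      subst (p ^ i * k <_) (pⁱ[xp]≡pⁱ⁺¹x p i e) (*-monoʳ-< (p ^ i) k<ep) ,
      ι≤θ-coprime-scale {{∣-nonZero c∣k}} (∤⇒coprime-^ (suc i) p-prime (λ p∣c → p∤k (∣-trans p∣c c∣k)))
        (subst (_≤ p ^ i * k) (pⁱ[xp]≡pⁱ⁺¹x p i c) (*-monoʳ-≤ (p ^ i) (<⇒≤ cp<k))) e≤θc
      where
      instance
        _ = pⁱ-nonZero i
        _ = pⁱ-nonZero (suc i)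
      k<ep : k < e * p
      k<ep with <-cmp k (e * p)
      ... | tri< k<ep _ _ = k<ep
      ... | tri≈ _ k≡ep _ = contradiction (divides e k≡ep) p∤k
      ... | tri> _ _ ep<k = contradiction (largest (e∣k , ep<k)) (<⇒≱ c<e)

    ladder-*-prime-power : ι p ≤∞ θ k → ∀ a → DivisorLadder θ (k * p ^ a)
    ladder-*-prime-power p≤θk a d∣kpᵃ d<kpᵃ
      with divisor-*-prime-power {a = a} p-prime p∤k d∣kpᵃ
    ... | i , d′ , refl , i≤a , d′∣k , p∤d′ with d′ <? k
    ...   | yes d′<k = step-below-k {a = a} i≤a d′∣k d′<k p∤d′
    ...   | no d′≮k with ≤-antisym (∣⇒≤ d′∣k) (≮⇒≥ d′≮k)
    ...     | refl with <-cmp k p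
    ...       | tri< k<p _ _ = step-by-p {a = a} (pⁱk<kpᵃ⇒i<a i≤a d<kpᵃ) k<p p≤θk
    ...       | tri≈ _ k≡p _ = contradiction (subst (p ∣_) (sym k≡p) ∣-refl) p∤k
    ...       | tri> _ _ p<k = step-via-largest {a = a} (pⁱk<kpᵃ⇒i<a i≤a d<kpᵃ) p<k

  BCond⇒ladder : ∀ {k} fs .{{_ : NonZero k}} → DivisorLadder θ k →
                 All PrimePower fs → Linked (_<_ on proj₁) fs → All (λ pa → ¬ proj₁ pa ∣ k) fs →
                 BCond θ k fs → DivisorLadder θ (k * prodPP fs)
  BCond⇒ladder {k} [] ladder _ _ _ _ = subst (DivisorLadder θ) (sym (*-identityʳ k)) ladder
  BCond⇒ladder {k} ((p , a) ∷ fs) ladder ((p-prime , _) ∷ primes) sorted (p∤k ∷ fs∤k) (p≤θk , bcond) =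
    subst (DivisorLadder θ) (*-assoc k (p ^ a) (prodPP fs))
      (BCond⇒ladder fs (ladder-*-prime-power ladder p-prime p∤k p≤θk a)
        primes (Linked.tail sorted) fs∤kpᵃ bcond)
    where
    instance
      pᵃ-nonZero : NonZero (p ^ a)
      pᵃ-nonZero = m^n≢0 p a {{prime⇒nonZero p-prime}}
      kpᵃ-nonZero : NonZero (k * p ^ a)
      kpᵃ-nonZero = m*n≢0 k (p ^ a)
    fs∤kpᵃ : All (λ pa → ¬ proj₁ pa ∣ k * p ^ a) fs
    fs∤kpᵃ with Linked⇒AllPairs <-trans sorted
    ... | p<fs ∷ _ =
      All.zipWith (λ (((q-prime , _) , p<q) , q∤k) → prime∤*^ a p-prime q-prime (>⇒≢ p<q) q∤k)
                  (All.zip (primes , p<fs) , fs∤k)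

  InB⇒InD : ∀ n → InB θ n → InD θ n
  InB⇒InD _ (fs , (primes , sorted , refl) , bcond) =
    ladder⇒InD (>-nonZero⁻¹ (prodPP fs))
      (subst (DivisorLadder θ) (*-identityˡ (prodPP fs))
        (BCond⇒ladder fs (ladder-1 {θ}) primes sorted (All.map (prime∤1 ∘ proj₁) primes) bcond))
    where instance _ = prodPP-nonZero primes

-- The lower bounds θ(1) ≥ 2 and θ(n) ≥ P⁺(n) are needed by neither inclusion.
theorem2p5 : (θ : ℕ → ℚ∞) →
    ι 2 ≤∞ θ 1 →
    (∀ n p → 2 ≤ n → IsLargestPrimeFactor n p → ι p ≤∞ θ n) →
    (∀ n → InD θ n → InB θ n)
    × ((∀ n → 1 ≤ n → θ n ≤∞ θ (suc n)) →
       (∀ n m → 1 ≤ n → 1 ≤ m → Coprime n m → m ·∞ θ n ≤∞ θ (m * n)) →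
       ∀ n → InD θ n ⇔ InB θ n)
theorem2p5 θ _ _ =
  InD⇒InB ,
  λ θ-mono θ-coprime-* n → mk⇔ (InD⇒InB n) (InB⇒InD θ-mono θ-coprime-* n)
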